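{- Let $(L,\vee,\wedge,0,1)$ be a finite complemented lattice such that the mapping $x\mapsto x^{++}$ from $L$ to $2^L$ is injective, and let $a\in L$ with $a^{++}\neq\{a\}$. Then there exists some $b\in a^{++}$ with $b^{++}=\{b\}$.
   Context: A bounded lattice is complemented if every element $a$ has some $b$ with $a\vee b=1$, $a\wedge b=0$ (complements need not be unique); lattices are non-trivial. For $A\subseteq L$, $A^+:=\{x\in L\mid a\vee x=1\text{ and }a\wedge x=0\text{ for all }a\in A\}$; $a^+:=\{a\}^+$ and $a^{++}:=(a^+)^+$. -}

module Defs where

open import Level using (Level; _⊔_)
open import Data.Nat using (ℕ)
open import Data.Fin using (Fin)
open import Data.Product using (Σ; ∃; ∃-syntax; _×_; _,_)
open import Relation.Nullary using (¬_)
open import Relation.Binary.Definitions using (Decidable)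
open import Relation.Binary.Lattice.Bundles using (BoundedLattice)
open import Function.Bundles using (_⇔_)

module _ {c ℓ₁ ℓ₂ : Level} (L : BoundedLattice c ℓ₁ ℓ₂) where
  open BoundedLattice L

  IsComplementOf : Carrier → Carrier → Set ℓ₁
  IsComplementOf a x = ((a ∨ x) ≈ ⊤) × ((a ∧ x) ≈ ⊥)

  Complemented : Set (c ⊔ ℓ₁)
  Complemented = ∀ a → ∃[ b ] IsComplementOf a b

  NonTrivial : Set ℓ₁
  NonTrivial = ¬ (⊤ ≈ ⊥)

  Finite : Set (c ⊔ ℓ₁)
  Finite = ∃[ n ] Σ (Fin n → Carrier) λ f → ∀ x → ∃[ i ] (f i ≈ x)


  _⁺ˢ : (Carrier → Set (c ⊔ ℓ₁)) → Carrier → Set (c ⊔ ℓ₁)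
  (A ⁺ˢ) x = ∀ a → A a → IsComplementOf a x

  _⁺ : Carrier → Carrier → Set (c ⊔ ℓ₁)
  a ⁺ = (λ y → Level.Lift c (y ≈ a)) ⁺ˢ

  _⁺⁺ : Carrier → Carrier → Set (c ⊔ ℓ₁)
  a ⁺⁺ = (a ⁺) ⁺ˢ

  _≐_ : (Carrier → Set (c ⊔ ℓ₁)) → (Carrier → Set (c ⊔ ℓ₁)) → Set (c ⊔ ℓ₁)
  A ≐ B = ∀ x → A x ⇔ B x

  ｛_｝ : Carrier → Carrier → Set (c ⊔ ℓ₁)
  ｛ a ｝ x = Level.Lift c (x ≈ a)

  PlusPlusInjective : Set (c ⊔ ℓ₁)
  PlusPlusInjective = ∀ x y → (x ⁺⁺) ≐ (y ⁺⁺) → x ≈ y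

-- Since x⁺⁺ consists of the complements of all complements of x, b ∈ a⁺⁺ gives
-- b⁺ ⊇ a⁺ and hence b⁺⁺ ⊆ a⁺⁺.  So "b ∈ a⁺⁺" is a preorder, and injectivity of
-- x ↦ x⁺⁺ makes it a partial order.  On a finite lattice every element lies
-- above a minimal one, and b is minimal exactly when b⁺⁺ = {b}.
module Submission where

open import Defs
open import Level using (Level; _⊔_; lift; lower)
open import Data.Nat using (ℕ)
open import Data.Fin using (Fin)
open import Data.Fin.Properties using (all?; any?)
open import Data.Fin.Induction using (po-wellFounded)
open import Data.Product using (∃-syntax; _×_; _,_; proj₁)
open import Function.Base using (_on_)
open import Function.Bundles using (_⇔_; mk⇔)
open import Induction.WellFounded using (Acc; acc)
open import Relation.Binary.Core using (Rel)
open import Relation.Binary.Definitions using (Decidable)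
open import Relation.Binary.Structures using (IsPartialOrder)
open import Relation.Binary.Lattice.Bundles using (BoundedLattice)
import Relation.Binary.Construct.On as On
import Relation.Binary.Construct.NonStrictToStrict as ToStrict
open import Relation.Nullary using (¬_; Dec; yes; no)
open import Relation.Nullary.Decidable as Dec using (_×-dec_; _→-dec_; ¬?)
open import Relation.Nullary.Negation using (contradiction)

module _ {a ℓ₁ ℓ₂} {A : Set a} {_≈_ : Rel A ℓ₁} {_⊑_ : Rel A ℓ₂}
         (isPartialOrder : IsPartialOrder _≈_ _⊑_)
         (_≈?_ : Decidable _≈_) (_⊑?_ : Decidable _⊑_)
         {n : ℕ} (f : Fin n → A) (f-surjective : ∀ x → ∃[ i ] (f i ≈ x)) where

  open IsPartialOrder isPartialOrder

  IsMinimal : A → Set (a ⊔ ℓ₁ ⊔ ℓ₂)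
  IsMinimal m = ∀ y → y ⊑ m → y ≈ m

  private
    _⊏_ : Rel (Fin n) (ℓ₁ ⊔ ℓ₂)
    _⊏_ = ToStrict._<_ (_≈_ on f) (_⊑_ on f)

    minimal-below-acc : ∀ i → Acc _⊏_ i → ∃[ m ] (m ⊑ f i × IsMinimal m)
    minimal-below-acc i (acc rec) with any? (λ j → (f j ⊑? f i) ×-dec ¬? (f j ≈? f i))
    ... | yes (j , j⊏i) =
      let m , m⊑fj , m-minimal = minimal-below-acc j (rec j⊏i)
      in m , trans m⊑fj (proj₁ j⊏i) , m-minimal
    ... | no ∄j⊏i = f i , refl , fi-minimal
      where
      fi-minimal : IsMinimal (f i)
      fi-minimal y y⊑fi with f-surjective y
      ... | j , fj≈y with f j ≈? f i
      ...   | yes fj≈fi = Eq.trans (Eq.sym fj≈y) fj≈fi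
      ...   | no fj≉fi = contradiction (j , ≤-respˡ-≈ (Eq.sym fj≈y) y⊑fi , fj≉fi) ∄j⊏i

  minimal-below : ∀ x → ∃[ m ] (m ⊑ x × IsMinimal m)
  minimal-below x =
    let i , fi≈x = f-surjective x
        m , m⊑fi , m-minimal = minimal-below-acc i
          (po-wellFounded (On.isPartialOrder f isPartialOrder) i)
    in m , ≤-respʳ-≈ fi≈x m⊑fi , m-minimal

module _ {c ℓ₁ ℓ₂ : Level} (L : BoundedLattice c ℓ₁ ℓ₂) where
  open BoundedLattice L
    using (Carrier; _≈_; _∨_; _∧_; ⊤; ⊥; isEquivalence; module Eq; joinSemilattice; meetSemilattice)
  open import Relation.Binary.Lattice.Properties.JoinSemilattice joinSemilattice using (∨-comm; ∨-cong)
  open import Relation.Binary.Lattice.Properties.MeetSemilattice meetSemilattice using (∧-comm; ∧-cong)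

  IsComplementOf-sym : ∀ {x y} → IsComplementOf L x y → IsComplementOf L y x
  IsComplementOf-sym {x} {y} (x∨y≈⊤ , x∧y≈⊥) =
    Eq.trans (∨-comm y x) x∨y≈⊤ , Eq.trans (∧-comm y x) x∧y≈⊥

  IsComplementOf-resp-≈ : ∀ {x x′ y y′} → x ≈ x′ → y ≈ y′ →
                          IsComplementOf L x y → IsComplementOf L x′ y′
  IsComplementOf-resp-≈ x≈x′ y≈y′ (x∨y≈⊤ , x∧y≈⊥) =
    Eq.trans (∨-cong (Eq.sym x≈x′) (Eq.sym y≈y′)) x∨y≈⊤ ,
    Eq.trans (∧-cong (Eq.sym x≈x′) (Eq.sym y≈y′)) x∧y≈⊥

  ⁺-intro : ∀ {x y} → IsComplementOf L x y → _⁺ L x y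
  ⁺-intro x-y _ (lift z≈x) = IsComplementOf-resp-≈ (Eq.sym z≈x) Eq.refl x-y

  ⁺-elim : ∀ {x y} → _⁺ L x y → IsComplementOf L x y
  ⁺-elim y∈x⁺ = y∈x⁺ _ (lift Eq.refl)

  _∈⁺⁺_ : Rel Carrier (c ⊔ ℓ₁)
  y ∈⁺⁺ x = _⁺⁺ L x y

  ∈⁺⁺-refl : ∀ x → x ∈⁺⁺ x
  ∈⁺⁺-refl x y y∈x⁺ = IsComplementOf-sym (⁺-elim y∈x⁺)

  ∈⁺⁺-respˡ-≈ : ∀ {x y y′} → y ≈ y′ → y ∈⁺⁺ x → y′ ∈⁺⁺ x
  ∈⁺⁺-respˡ-≈ y≈y′ y∈x⁺⁺ z z∈x⁺ = IsComplementOf-resp-≈ Eq.refl y≈y′ (y∈x⁺⁺ z z∈x⁺)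

  ∈⁺⁺-trans : ∀ {x y z} → x ∈⁺⁺ y → y ∈⁺⁺ z → x ∈⁺⁺ z
  ∈⁺⁺-trans x∈y⁺⁺ y∈z⁺⁺ w w∈z⁺ = x∈y⁺⁺ w (⁺-intro (IsComplementOf-sym (y∈z⁺⁺ w w∈z⁺)))

  ∈⁺⁺-antisym : PlusPlusInjective L → ∀ {x y} → x ∈⁺⁺ y → y ∈⁺⁺ x → x ≈ y
  ∈⁺⁺-antisym ⁺⁺-injective x∈y⁺⁺ y∈x⁺⁺ =
    ⁺⁺-injective _ _ λ z → mk⇔ (λ z∈x⁺⁺ → ∈⁺⁺-trans z∈x⁺⁺ x∈y⁺⁺)
                                (λ z∈y⁺⁺ → ∈⁺⁺-trans z∈y⁺⁺ y∈x⁺⁺)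

  ∈⁺⁺-isPartialOrder : PlusPlusInjective L → IsPartialOrder _≈_ _∈⁺⁺_
  ∈⁺⁺-isPartialOrder ⁺⁺-injective = record
    { isPreorder = record
      { isEquivalence = isEquivalence
      ; reflexive = λ x≈y → ∈⁺⁺-respˡ-≈ (Eq.sym x≈y) (∈⁺⁺-refl _)
      ; trans = ∈⁺⁺-trans
      }
    ; antisym = ∈⁺⁺-antisym ⁺⁺-injective
    }

  ∈⁺⁺-dec : Decidable _≈_ → Finite L → Decidable _∈⁺⁺_
  ∈⁺⁺-dec _≈?_ (_ , f , f-surjective) y x =
    Dec.map ∈⁺⁺⇔ (all? λ i → complement? x (f i) →-dec complement? (f i) y)
    where
    complement? : ∀ u v → Dec (IsComplementOf L u v)
    complement? u v = ((u ∨ v) ≈? ⊤) ×-dec ((u ∧ v) ≈? ⊥)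

    ∈⁺⁺⇔ : (∀ i → IsComplementOf L x (f i) → IsComplementOf L (f i) y) ⇔ y ∈⁺⁺ x
    ∈⁺⁺⇔ = mk⇔
      (λ all-fi z z∈x⁺ →
         let i , fi≈z = f-surjective z
         in IsComplementOf-resp-≈ fi≈z Eq.refl
              (all-fi i (IsComplementOf-resp-≈ Eq.refl (Eq.sym fi≈z) (⁺-elim z∈x⁺))))
      (λ y∈x⁺⁺ i x-fi → y∈x⁺⁺ (f i) (⁺-intro x-fi))

proposition2p5 : {c ℓ₁ ℓ₂ : Level} (L : BoundedLattice c ℓ₁ ℓ₂) →
    Decidable (BoundedLattice._≈_ L) →
    Finite L → NonTrivial L → Complemented L → PlusPlusInjective L →
    (a : BoundedLattice.Carrier L) →
    ¬ (_≐_ L (_⁺⁺ L a) (｛_｝ L a)) →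
    ∃[ b ] (_⁺⁺ L a b × _≐_ L (_⁺⁺ L b) (｛_｝ L b))
proposition2p5 L _≈?_ finite@(_ , f , f-surjective) _ _ ⁺⁺-injective a _ =
  let b , b∈a⁺⁺ , b-minimal = minimal-below ∈⁺⁺-isPO _≈?_ (∈⁺⁺-dec L _≈?_ finite) f f-surjective a
  in b , b∈a⁺⁺ , λ x → mk⇔ (λ x∈b⁺⁺ → lift (b-minimal x x∈b⁺⁺))
                           (λ x≈b → IsPartialOrder.reflexive ∈⁺⁺-isPO (lower x≈b))
  where
  ∈⁺⁺-isPO : IsPartialOrder (BoundedLattice._≈_ L) (_∈⁺⁺_ L)
  ∈⁺⁺-isPO = ∈⁺⁺-isPartialOrder L ⁺⁺-injective
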